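{- Let $n \geq 1$, and let $v_1,\dots,v_n$ be positive integers such that $v_i \leq 1.2 n$ for all $i=1,\dots,n$. Then $\delta(v_1,\dots,v_n) \geq \frac{1}{n+1}$.
   Context: For $t \in \mathbb{R}/\mathbb{Z}$, $\|t\|_{\mathbb{R}/\mathbb{Z}}$ denotes the distance from (any representative of) $t$ to the nearest integer. For non-zero integers $v_1,\dots,v_n$, $\delta(v_1,\dots,v_n)$ denotes the maximum over $t \in \mathbb{R}/\mathbb{Z}$ of $\min(\|tv_1\|_{\mathbb{R}/\mathbb{Z}},\dots,\|tv_n\|_{\mathbb{R}/\mathbb{Z}})$. -}

module Defs where

open import Data.Nat as ℕ using (ℕ; suc)
open import Data.Integer as ℤ using (ℤ; +_)
open import Data.Rational using (ℚ; _/_; _-_; _*_; _⊓_; _≤_; floor; 1ℚ)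
open import Data.Fin using (Fin)
open import Data.Product using (∃-syntax)

-- ‖ x ‖_{ℝ/ℤ} : distance from x to the nearest integer (x rational).
-- With f = x - ⌊x⌋ ∈ [0,1), the distance is min(f, 1 - f).
‖_‖ : ℚ → ℚ
‖ x ‖ = f ⊓ (1ℚ - f)
  where f = x - (floor x / 1)

-- "δ(v_1,…,v_n) ≥ c": some t ∈ ℝ/ℤ has min_i ‖ t v_i ‖ ≥ c.
-- t ranges over ℚ; t is taken mod 1 implicitly
-- since ‖·‖ is 1-periodic in t for integer v_i.
δ≥ : (n : ℕ) → (Fin n → ℕ) → ℚ → Set
δ≥ n v c = ∃[ t ] (∀ i → c ≤ ‖ t * ((+ v i) / 1) ‖)

-- It suffices to find t = a/M such that every residue a·vᵢ mod M lies in [M/(n+1), M − M/(n+1)].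
-- If some m ≤ n+1 divides no vᵢ, take t = 1/m. Otherwise let b be the least positive integer
-- that is no vᵢ. As k·b ≡ −1 modulo k·b+1, the fraction t = k/(k·b+1) sends v = q·b + s to the
-- residue k·s − q, which lies in [2, k·b−1] whenever 0 < v < k·b and v ∉ {b, (k−1)·b+1}; this
-- suffices once k·b+1 ≤ 2(n+1). If 2b ≤ n, some k with (k−1)·b ≥ 6n/5 ≥ vᵢ still satisfies it.
-- If 2b > n, send each vᵢ to itself when vᵢ ≤ n+1 and to ⌊vᵢ/2⌋ otherwise: every y < b is some
-- vᵢ, and every y ≥ b with 2y > n+1 divides some vᵢ < 3y, so vᵢ ∈ {y, 2y}. The n images would
-- then cover 1, …, n+1 unless 2b = n+1 and n+2 is no vᵢ, and in that case k = 3 works.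
module Submission where

open import Defs
open import Data.Nat using (ℕ; suc; _≤_; _*_)
open import Data.Integer using (+_)
open import Data.Rational using (_/_)
open import Data.Fin using (Fin)

open import Data.Empty using (⊥-elim)
open import Data.Fin as Fin using (toℕ)
open import Data.Fin.Properties using (any?; pigeonhole; toℕ<n)
open import Data.Integer as ℤ using (-[1+_])
import Data.Integer.DivMod as ℤ
import Data.Integer.Properties as ℤ
open import Data.Integer.Tactic.RingSolver using (solve-∀)
open import Data.Nat as ℕ
  using (zero; NonZero; >-nonZero⁻¹; _+_; _∸_; _<_; z≤n; s≤s; ⌊_/2⌋; _%_; _≟_; _≤?_; _<?_)
open import Data.Nat.Coprimality using (Coprime)
open import Data.Nat.DivMod
  using (m%n<n; m≡m%n+[m/n]*n; m/n*n≤m; [m+kn]%n≡m%n; m<n⇒m%n≡m; m%n*o≡m*o%[n*o]; %-congˡ; %-congʳ)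
open import Data.Nat.Divisibility using (_∣_; _∣?_; divides; m%n≡0⇒n∣m)
open import Data.Nat.Properties
open import Algebra.Properties.CommutativeSemigroup *-commutativeSemigroup using (x∙yz≈y∙xz)
import Data.Nat.Tactic.RingSolver as ℕ-Ring
open import Data.Product using (_×_; _,_; ∃; ∃₂; proj₁; proj₂)
open import Data.Rational as ℚ using (ℚ; mkℚ; floor; 1ℚ; toℚᵘ)
import Data.Rational.Properties as ℚ
open import Data.Rational.Unnormalised as ℚᵘ using (mkℚᵘ; *≡*; *≤*; _≃_)
import Data.Rational.Unnormalised.Properties as ℚᵘ
open import Data.Sum using (_⊎_; inj₁; inj₂; [_,_]′)
open import Function using (_∘_)
open import Relation.Binary.PropositionalEquality
open import Relation.Nullary using (¬_; yes; no; contradiction)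
open import Relation.Unary using (Pred; Decidable)

Apart : ℕ → ℕ → ℕ → Set
Apart n M r = M ≤ suc n * r × M ≤ suc n * (M ∸ r)

fract : ℚ → ℚ
fract x = x ℚ.- (floor x / 1)

toℚᵘ-/ : ∀ i m → toℚᵘ (i / suc m) ≃ mkℚᵘ i m
toℚᵘ-/ i m = ℚ.toℚᵘ-fromℚᵘ (mkℚᵘ i m)

toℚᵘ-fract-mkℚ : ∀ P d .(c : Coprime ℤ.∣ P ∣ (suc d)) →
                 toℚᵘ (fract (mkℚ P d c)) ≃ mkℚᵘ (+ (P ℤ.% ℤ.+[1+ d ])) d
toℚᵘ-fract-mkℚ P d c = begin
  toℚᵘ (x ℚ.- (F / 1))               ≈⟨ ℚ.toℚᵘ-homo-+ x (ℚ.- (F / 1)) ⟩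
  toℚᵘ x ℚᵘ.+ toℚᵘ (ℚ.- (F / 1))     ≈⟨ ℚᵘ.+-congʳ (toℚᵘ x) (ℚ.toℚᵘ-homo‿- (F / 1)) ⟩
  toℚᵘ x ℚᵘ.- toℚᵘ (F / 1)           ≈⟨ ℚᵘ.+-congʳ (toℚᵘ x) (ℚᵘ.-‿cong (toℚᵘ-/ F 0)) ⟩
  mkℚᵘ P d ℚᵘ.- mkℚᵘ F 0             ≈⟨ *≡* (cross {+ (P ℤ.% D)} (ℤ.a≡a%n+[a/n]*n P D)) ⟩
  mkℚᵘ (+ (P ℤ.% D)) d               ∎
  where
  open ℚᵘ.≃-Reasoning
  x = mkℚ P d c
  F = floor x
  D = ℤ.+[1+ d ]
  identity : ∀ R F D → ((R ℤ.+ F ℤ.* D) ℤ.* ℤ.1ℤ ℤ.+ ℤ.- F ℤ.* D) ℤ.* D ≡ R ℤ.* (D ℤ.* ℤ.1ℤ)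
  identity = solve-∀
  cross : ∀ {R} → P ≡ R ℤ.+ F ℤ.* D → (P ℤ.* ℤ.1ℤ ℤ.+ ℤ.- F ℤ.* D) ℤ.* D ≡ R ℤ.* (D ℤ.* ℤ.1ℤ)
  cross {R} eq = trans (cong (λ p → (p ℤ.* ℤ.1ℤ ℤ.+ ℤ.- F ℤ.* D) ℤ.* D) eq) (identity R F D)

m*o≡n*p⇒[m%p]*o≡[n%o]*p : ∀ m n o p .{{_ : NonZero o}} .{{_ : NonZero p}} →
                          m * o ≡ n * p → (m % p) * o ≡ (n % o) * p
m*o≡n*p⇒[m%p]*o≡[n%o]*p m n o p eq = begin
  (m % p) * o          ≡⟨ m%n*o≡m*o%[n*o] m p o ⟩
  (m * o) % (p * o)    ≡⟨ %-congˡ eq ⟩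
  (n * p) % (p * o)    ≡⟨ %-congʳ (*-comm p o) ⟩
  (n * p) % (o * p)    ≡⟨ m%n*o≡m*o%[n*o] n o p ⟨
  (n % o) * p          ∎
  where
  open ≡-Reasoning
  instance
    _ = m*n≢0 p o
    _ = m*n≢0 o p

toℚᵘ-fract : ∀ {x N m} → toℚᵘ x ≃ mkℚᵘ (+ N) m → toℚᵘ (fract x) ≃ mkℚᵘ (+ (N % suc m)) m
toℚᵘ-fract {mkℚ -[1+ _ ] d _} {N} (*≡* eq) with () ← trans eq (sym (ℤ.pos-* N (suc d)))
toℚᵘ-fract {mkℚ (+ p) d c} {N} {m} (*≡* eq) =
  ℚᵘ.≃-trans (toℚᵘ-fract-mkℚ (+ p) d c) (*≡* (begin
    + (p % D) ℤ.* + M     ≡⟨ ℤ.pos-* (p % D) M ⟨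
    + ((p % D) * M)       ≡⟨ cong +_ (m*o≡n*p⇒[m%p]*o≡[n%o]*p p N M D (ℤ.+-injective pM≡ND)) ⟩
    + ((N % M) * D)       ≡⟨ ℤ.pos-* (N % M) D ⟩
    + (N % M) ℤ.* + D     ∎))
  where
  open ≡-Reasoning
  D = suc d
  M = suc m
  pM≡ND : + (p * M) ≡ + (N * D)
  pM≡ND = begin
    + (p * M)     ≡⟨ ℤ.pos-* p M ⟩
    + p ℤ.* + M   ≡⟨ eq ⟩
    + N ℤ.* + D   ≡⟨ ℤ.pos-* N D ⟨
    + (N * D)     ∎

toℚᵘ-1- : ∀ {q r m} → toℚᵘ q ≃ mkℚᵘ (+ r) m → r ≤ suc m → toℚᵘ (1ℚ ℚ.- q) ≃ mkℚᵘ (+ (suc m ∸ r)) m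
toℚᵘ-1- {q} {r} {m} q≃r/M r≤M = begin
  toℚᵘ (1ℚ ℚ.- q)                 ≈⟨ ℚ.toℚᵘ-homo-+ 1ℚ (ℚ.- q) ⟩
  toℚᵘ 1ℚ ℚᵘ.+ toℚᵘ (ℚ.- q)       ≈⟨ ℚᵘ.+-congʳ (toℚᵘ 1ℚ) (ℚ.toℚᵘ-homo‿- q) ⟩
  toℚᵘ 1ℚ ℚᵘ.- toℚᵘ q             ≈⟨ ℚᵘ.+-congʳ (toℚᵘ 1ℚ) (ℚᵘ.-‿cong q≃r/M) ⟩
  ℚᵘ.1ℚᵘ ℚᵘ.- mkℚᵘ (+ r) m        ≈⟨ *≡* (trans (identity (+ M) (+ r)) (cong (ℤ._* (ℤ.1ℤ ℤ.* + M)) M-r≡M∸r)) ⟩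
  mkℚᵘ (+ (M ∸ r)) m              ∎
  where
  open ℚᵘ.≃-Reasoning
  M = suc m
  identity : ∀ M r → (ℤ.1ℤ ℤ.* M ℤ.+ ℤ.- r ℤ.* ℤ.1ℤ) ℤ.* M ≡ (M ℤ.- r) ℤ.* (ℤ.1ℤ ℤ.* M)
  identity = solve-∀
  M-r≡M∸r : + M ℤ.- + r ≡ + (M ∸ r)
  M-r≡M∸r = trans (ℤ.m-n≡m⊖n M r) (ℤ.⊖-≥ r≤M)

1/[1+n]≤ : ∀ {q r m} n → toℚᵘ q ≃ mkℚᵘ (+ r) m → suc m ≤ suc n * r → + 1 / suc n ℚ.≤ q
1/[1+n]≤ {r = r} {m} n q≃r/M M≤[1+n]r = ℚ.toℚᵘ-cancel-≤
  (ℚᵘ.≤-respˡ-≃ (ℚᵘ.≃-sym (toℚᵘ-/ (+ 1) n)) (ℚᵘ.≤-respʳ-≃ (ℚᵘ.≃-sym q≃r/M) (*≤* cross)))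
  where
  cross : + 1 ℤ.* + suc m ℤ.≤ + r ℤ.* + suc n
  cross = subst₂ ℤ._≤_ (sym (ℤ.*-identityˡ (+ suc m))) (ℤ.pos-* r (suc n))
            (ℤ.+≤+ (≤-trans M≤[1+n]r (≤-reflexive (*-comm (suc n) r))))

‖‖≥1/[1+n] : ∀ {x N m} n → toℚᵘ x ≃ mkℚᵘ (+ N) m → Apart n (suc m) (N % suc m) → + 1 / suc n ℚ.≤ ‖ x ‖
‖‖≥1/[1+n] {x} {N} {m} n x≃N/M (lower , upper) = ℚ.⊓-glb
  (1/[1+n]≤ n fract≃r/M lower)
  (1/[1+n]≤ n (toℚᵘ-1- fract≃r/M (<⇒≤ (m%n<n N (suc m)))) upper)
  where
  fract≃r/M : toℚᵘ (fract x) ≃ mkℚᵘ (+ (N % suc m)) m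
  fract≃r/M = toℚᵘ-fract x≃N/M

toℚᵘ-a/M*v : ∀ a m v → toℚᵘ ((+ a / suc m) ℚ.* (+ v / 1)) ≃ mkℚᵘ (+ (a * v)) m
toℚᵘ-a/M*v a m v = begin
  toℚᵘ ((+ a / suc m) ℚ.* (+ v / 1))        ≈⟨ ℚ.toℚᵘ-homo-* (+ a / suc m) (+ v / 1) ⟩
  toℚᵘ (+ a / suc m) ℚᵘ.* toℚᵘ (+ v / 1)    ≈⟨ ℚᵘ.*-cong (toℚᵘ-/ (+ a) m) (toℚᵘ-/ (+ v) 0) ⟩
  mkℚᵘ (+ a) m ℚᵘ.* mkℚᵘ (+ v) 0            ≈⟨ *≡* (cong₂ ℤ._*_ (sym (ℤ.pos-* a v)) (sym (ℤ.*-identityʳ (+ suc m)))) ⟩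
  mkℚᵘ (+ (a * v)) m                        ∎
  where open ℚᵘ.≃-Reasoning

apart-bounds : ∀ {n M r} c → c ≤ r → c + r ≤ M → M ≤ c * suc n → Apart n M r
apart-bounds {n} {M} {r} c c≤r c+r≤M M≤c[1+n] =
  ≤-trans M≤[1+n]c (*-monoʳ-≤ (suc n) c≤r) ,
  ≤-trans M≤[1+n]c (*-monoʳ-≤ (suc n) (m+n≤o⇒m≤o∸n c c+r≤M))
  where
  M≤[1+n]c : M ≤ suc n * c
  M≤[1+n]c = ≤-trans M≤c[1+n] (≤-reflexive (*-comm c (suc n)))

m≡r+q*n⇒m%n≡r : ∀ {m r q n} .{{_ : NonZero n}} → m ≡ r + q * n → r < n → m % n ≡ r
m≡r+q*n⇒m%n≡r {r = r} {q} {n} refl r<n = trans ([m+kn]%n≡m%n r q n) (m<n⇒m%n≡m r<n)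

apart-nondivisor : ∀ {n m v} .{{_ : NonZero m}} → m ≤ suc n → ¬ m ∣ v → Apart n m (v % m)
apart-nondivisor {m = m} {v} m≤1+n m∤v =
  apart-bounds 1 (n≢0⇒n>0 (m∤v ∘ m%n≡0⇒n∣m v m)) (m%n<n v m)
                 (≤-trans m≤1+n (≤-reflexive (sym (*-identityˡ _))))

apart-by-remainder : ∀ {n a r q M} .{{_ : NonZero M}} →
                     a ≡ r + q * M → 2 ≤ r → 2 + r ≤ M → M ≤ 2 * suc n → Apart n M (a % M)
apart-by-remainder {n} {q = q} {M} a≡r+qM 2≤r 2+r≤M M≤2[1+n] =
  subst (Apart n M) (sym (m≡r+q*n⇒m%n≡r {q = q} a≡r+qM (≤-trans (m≤n+m _ 1) 2+r≤M)))
        (apart-bounds 2 2≤r 2+r≤M M≤2[1+n])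

-- Modulo M = k * b + 1 we have k * b ≡ -1, so k * (s + q * b) ≡ k * s - q.
module _ (j b : ℕ) .{{_ : NonZero b}} where
  private
    k = suc j
    K = k * b

  k*[[1+p]*b]≡[K∸p]+p*[1+K] : ∀ p → p ≤ K → k * (suc p * b) ≡ (K ∸ p) + p * suc K
  k*[[1+p]*b]≡[K∸p]+p*[1+K] p p≤K = begin
    k * (suc p * b)         ≡⟨ x∙yz≈y∙xz k (suc p) b ⟩
    K + p * K               ≡⟨ cong (_+ p * K) (m∸n+n≡m p≤K) ⟨
    (K ∸ p) + p + p * K     ≡⟨ +-assoc (K ∸ p) p (p * K) ⟩
    (K ∸ p) + (p + p * K)   ≡⟨ cong (_+_ (K ∸ p)) (*-suc p K) ⟨
    (K ∸ p) + p * suc K     ∎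
    where open ≡-Reasoning

  k*[s+q*b]≡[k*s∸q]+q*[1+K] : ∀ s q → q ≤ k * s → k * (s + q * b) ≡ (k * s ∸ q) + q * suc K
  k*[s+q*b]≡[k*s∸q]+q*[1+K] s q q≤ks = begin
    k * (s + q * b)             ≡⟨ *-distribˡ-+ k s (q * b) ⟩
    k * s + k * (q * b)         ≡⟨ cong₂ _+_ (m∸n+n≡m q≤ks) (x∙yz≈y∙xz q k b) ⟨
    (k * s ∸ q) + q + q * K     ≡⟨ +-assoc (k * s ∸ q) q (q * K) ⟩
    (k * s ∸ q) + (q + q * K)   ≡⟨ cong (_+_ (k * s ∸ q)) (*-suc q K) ⟨
    (k * s ∸ q) + q * suc K     ∎
    where open ≡-Reasoning

  apart-multiple : ∀ {n} p → 1 ≤ p → suc p ≤ j → suc K ≤ 2 * suc n →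
                   Apart n (suc K) ((k * (suc p * b)) % suc K)
  apart-multiple p 1≤p 1+p≤j M≤2[1+n] =
    apart-by-remainder {q = p} (k*[[1+p]*b]≡[K∸p]+p*[1+K] p p≤K) (m+n≤o⇒m≤o∸n 2 2+p≤K) 2+[K∸p]≤M M≤2[1+n]
    where
    open ≤-Reasoning
    2+p≤K : 2 + p ≤ K
    2+p≤K = ≤-trans (s≤s 1+p≤j) (m≤m*n k b)
    p≤K : p ≤ K
    p≤K = ≤-trans (m≤n+m p 2) 2+p≤K
    2+[K∸p]≤M : 2 + (K ∸ p) ≤ suc K
    2+[K∸p]≤M = s≤s (begin
      suc (K ∸ p)   ≡⟨ +-comm 1 (K ∸ p) ⟩
      (K ∸ p) + 1   ≤⟨ +-monoʳ-≤ (K ∸ p) 1≤p ⟩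
      (K ∸ p) + p   ≡⟨ m∸n+n≡m p≤K ⟩
      K             ∎)

  apart-nonmultiple : ∀ {n} s q → s < b → 2 + q ≤ k * s → suc K ≤ 2 * suc n →
                      Apart n (suc K) ((k * (s + q * b)) % suc K)
  apart-nonmultiple s q s<b 2+q≤ks M≤2[1+n] =
    apart-by-remainder {q = q} (k*[s+q*b]≡[k*s∸q]+q*[1+K] s q (≤-trans (m≤n+m q 2) 2+q≤ks))
                       (m+n≤o⇒m≤o∸n 2 2+q≤ks) 2+[ks∸q]≤M M≤2[1+n]
    where
    open ≤-Reasoning
    2+[ks∸q]≤M : 2 + (k * s ∸ q) ≤ suc K
    2+[ks∸q]≤M = begin
      2 + (k * s ∸ q)   ≤⟨ +-monoʳ-≤ 2 (m∸n≤m (k * s) q) ⟩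
      2 + k * s         ≤⟨ s≤s (+-monoˡ-≤ (k * s) (s≤s (z≤n {j}))) ⟩
      suc (k + k * s)   ≡⟨ cong suc (*-suc k s) ⟨
      suc (k * suc s)   ≤⟨ s≤s (*-monoʳ-≤ k s<b) ⟩
      suc K             ∎

  apart-k*v : ∀ {n v} → suc K ≤ 2 * suc n → 0 < v → v < K → v ≢ b → v ≢ suc (j * b) →
              Apart n (suc K) ((k * v) % suc K)
  apart-k*v {n} {v} M≤2[1+n] =
    decomposed (v % b) (v ℕ./ b) (m≡m%n+[m/n]*n v b) (m%n<n v b)
    where
    q≤j : ∀ s q → s + q * b < K → q ≤ j
    q≤j s q v<K = ≤-pred (*-cancelʳ-< b q k (≤-<-trans (m≤n+m (q * b) s) v<K))

    decomposed : ∀ {v} s q → v ≡ s + q * b → s < b →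
                 0 < v → v < K → v ≢ b → v ≢ suc (j * b) → Apart n (suc K) ((k * v) % suc K)
    decomposed zero zero refl _ () _ _ _
    decomposed zero (suc zero) refl _ _ _ v≢b _ = contradiction (+-identityʳ b) v≢b
    decomposed zero (suc (suc p)) refl _ _ v<K _ _ =
      apart-multiple (suc p) (s≤s z≤n) (q≤j 0 (2 + p) v<K) M≤2[1+n]
    decomposed (suc zero) q refl s<b _ v<K _ v≢1+jb =
      apart-nonmultiple 1 q s<b (≤-trans (s≤s q<j) (≤-reflexive (sym (*-identityʳ k)))) M≤2[1+n]
      where
      q<j : q < j
      q<j = ≤∧≢⇒< (q≤j 1 q v<K) (λ q≡j → v≢1+jb (cong (λ x → suc (x * b)) q≡j))
    decomposed (suc (suc s)) q refl s<b _ v<K _ _ =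
      apart-nonmultiple (2 + s) q s<b
        (≤-trans (+-monoʳ-≤ 2 (≤-trans (q≤j (2 + s) q v<K) (m≤m*n j 2))) (*-monoʳ-≤ k (s≤s (s≤s z≤n))))
        M≤2[1+n]

least-failure : ∀ {p} {P : Pred ℕ p} → Decidable P → ∀ m →
                (∀ {x} → x < m → P x) ⊎ ∃ λ b → b < m × ¬ P b × (∀ {x} → x < b → P x)
least-failure P? zero = inj₁ λ ()
least-failure P? (suc m) with least-failure P? m
... | inj₂ (b , b<m , ¬Pb , below) = inj₂ (b , m<n⇒m<1+n b<m , ¬Pb , below)
... | inj₁ below with P? m
...   | no ¬Pm = inj₂ (m , n<1+n m , ¬Pm , below)
...   | yes Pm = inj₁ λ x<1+m → [ below , (λ { refl → Pm }) ]′ (m<1+n⇒m<n∨m≡n x<1+m)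

cannot-cover : ∀ {n} (f : Fin n → ℕ) → ¬ (∀ {y} → y < suc n → ∃ λ i → f i ≡ suc y)
cannot-cover {n} f cover = no-collision (pigeonhole (n<1+n n) preimage)
  where
  preimage : Fin (suc n) → Fin n
  preimage y = proj₁ (cover (toℕ<n y))
  hits : ∀ y → f (preimage y) ≡ suc (toℕ y)
  hits y = proj₂ (cover (toℕ<n y))
  no-collision : ¬ ∃₂ λ x y → x Fin.< y × preimage x ≡ preimage y
  no-collision (x , y , x<y , same) =
    <-irrefl (suc-injective (trans (sym (hits x)) (trans (cong f same) (hits y)))) x<y

⌊2*n/2⌋≡n : ∀ n → ⌊ 2 * n /2⌋ ≡ n
⌊2*n/2⌋≡n zero = refl
⌊2*n/2⌋≡n (suc n) rewrite +-suc n (n + 0) = cong suc (⌊2*n/2⌋≡n n)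

⌊1+2*n/2⌋≡n : ∀ n → ⌊ suc (2 * n) /2⌋ ≡ n
⌊1+2*n/2⌋≡n zero = refl
⌊1+2*n/2⌋≡n (suc n) rewrite +-suc n (n + 0) = cong suc (⌊1+2*n/2⌋≡n n)

shrink : ℕ → ℕ → ℕ
shrink n w with w ≤? suc n
... | yes _ = w
... | no  _ = ⌊ w /2⌋

shrink-≤ : ∀ {n w} → w ≤ suc n → shrink n w ≡ w
shrink-≤ {n} {w} w≤1+n with w ≤? suc n
... | yes _ = refl
... | no w≰1+n = contradiction w≤1+n w≰1+n

shrink-> : ∀ {n w} → suc n < w → shrink n w ≡ ⌊ w /2⌋
shrink-> {n} {w} 1+n<w with w ≤? suc n
... | yes w≤1+n = contradiction w≤1+n (<⇒≱ 1+n<w)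
... | no _ = refl

small-multiple : ∀ {y w} → y ∣ w → 0 < w → w < 3 * y → w ≡ y ⊎ w ≡ 2 * y
small-multiple (divides zero refl) () _
small-multiple {y} (divides 1 refl) _ _ = inj₁ (+-identityʳ y)
small-multiple (divides 2 refl) _ _ = inj₂ refl
small-multiple {y} (divides (suc (suc (suc c))) refl) _ w<3y =
  contradiction (*-monoˡ-≤ y (m≤m+n 3 c)) (<⇒≱ w<3y)

5w≤6n⇒w<3y : ∀ {n w y} → 5 * w ≤ 6 * n → suc n ≤ 2 * y → w < 3 * y
5w≤6n⇒w<3y {n} {w} {y} 5w≤6n 1+n≤2y = *-cancelˡ-< 10 w (3 * y) (begin-strict
  10 * w          ≡⟨ *-assoc 2 5 w ⟩
  2 * (5 * w)     ≤⟨ *-monoʳ-≤ 2 5w≤6n ⟩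
  2 * (6 * n)     ≡⟨ *-assoc 2 6 n ⟨
  12 * n          <⟨ *-monoʳ-< 12 (n<1+n n) ⟩
  12 * suc n      ≤⟨ *-monoˡ-≤ (suc n) (m≤m+n 12 3) ⟩
  15 * suc n      ≤⟨ *-monoʳ-≤ 15 1+n≤2y ⟩
  15 * (2 * y)    ≡⟨ *-assoc 15 2 y ⟨
  30 * y          ≡⟨ *-assoc 10 3 y ⟩
  10 * (3 * y)    ∎)
  where open ≤-Reasoning

shrink-multiple : ∀ {n y w} → y ∣ w → 0 < w → 5 * w ≤ 6 * n → y ≤ suc n → suc n < 2 * y → shrink n w ≡ y
shrink-multiple {n} {y} {w} y∣w 0<w 5w≤6n y≤1+n 1+n<2y =
  [ (λ w≡y → trans (cong (shrink n) w≡y) (shrink-≤ y≤1+n))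
  , (λ w≡2y → trans (cong (shrink n) w≡2y) (trans (shrink-> 1+n<2y) (⌊2*n/2⌋≡n y)))
  ]′ (small-multiple y∣w 0<w (5w≤6n⇒w<3y {y = y} 5w≤6n (<⇒≤ 1+n<2y)))

shrink-2+n : ∀ {n y} → suc n ≡ 2 * y → shrink n (suc (suc n)) ≡ y
shrink-2+n {n} {y} 1+n≡2y = begin
  shrink n (suc (suc n))   ≡⟨ shrink-> (n<1+n (suc n)) ⟩
  ⌊ suc (suc n) /2⌋        ≡⟨ cong (λ x → ⌊ suc x /2⌋) 1+n≡2y ⟩
  ⌊ suc (2 * y) /2⌋        ≡⟨ ⌊1+2*n/2⌋≡n y ⟩
  y                        ∎
  where open ≡-Reasoning

multiplier : ∀ {n b} .{{_ : NonZero b}} → 2 * b ≤ n →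
             ∃ λ j → suc (suc j * b) ≤ 2 * suc n × 6 * n ≤ 5 * (j * b)
multiplier {n} {b} 2b≤n with ≤-total (5 * b) (2 * n)
... | inj₂ 2n≤5b = 3 , M≤2[1+n] , 6n≤15b
  where
  open ≤-Reasoning
  M≤2[1+n] : suc (4 * b) ≤ 2 * suc n
  M≤2[1+n] = begin
    suc (4 * b)          ≡⟨ cong suc (*-assoc 2 2 b) ⟩
    suc (2 * (2 * b))    ≤⟨ s≤s (*-monoʳ-≤ 2 2b≤n) ⟩
    suc (2 * n)          ≤⟨ n≤1+n _ ⟩
    2 + 2 * n            ≡⟨ *-suc 2 n ⟨
    2 * suc n            ∎
  6n≤15b : 6 * n ≤ 5 * (3 * b)
  6n≤15b = begin
    6 * n          ≡⟨ *-assoc 3 2 n ⟩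
    3 * (2 * n)    ≤⟨ *-monoʳ-≤ 3 2n≤5b ⟩
    3 * (5 * b)    ≡⟨ x∙yz≈y∙xz 3 5 b ⟩
    5 * (3 * b)    ∎
... | inj₁ 5b≤2n = suc Q , *-cancelˡ-≤ 5 5M≤10[1+n] , <⇒≤ 6n<5[1+Q]b
  where
  instance _ = m*n≢0 5 b
  open ≤-Reasoning
  Q = (6 * n) ℕ./ (5 * b)
  6n<5[1+Q]b : 6 * n < 5 * (suc Q * b)
  6n<5[1+Q]b = begin-strict
    6 * n                              ≡⟨ m≡m%n+[m/n]*n (6 * n) (5 * b) ⟩
    (6 * n) % (5 * b) + Q * (5 * b)    <⟨ +-monoˡ-< (Q * (5 * b)) (m%n<n (6 * n) (5 * b)) ⟩
    suc Q * (5 * b)                    ≡⟨ x∙yz≈y∙xz (suc Q) 5 b ⟩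
    5 * (suc Q * b)                    ∎
  5M≤10[1+n] : 5 * suc (suc (suc Q) * b) ≤ 5 * (2 * suc n)
  5M≤10[1+n] = begin
    5 * suc (suc (suc Q) * b)                ≡⟨ *-suc 5 _ ⟩
    5 + 5 * (suc (suc Q) * b)                ≡⟨ cong (_+_ 5) (x∙yz≈y∙xz 5 (suc (suc Q)) b) ⟩
    5 + (5 * b + (5 * b + Q * (5 * b)))      ≤⟨ +-monoʳ-≤ 5 (+-mono-≤ 5b≤2n (+-mono-≤ 5b≤2n (m/n*n≤m (6 * n) (5 * b)))) ⟩
    5 + (2 * n + (2 * n + 6 * n))            ≤⟨ m≤m+n _ 5 ⟩
    5 + (2 * n + (2 * n + 6 * n)) + 5        ≡⟨ identity n ⟩
    5 * (2 * suc n)                          ∎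
    where
    identity : ∀ n → 5 + (2 * n + (2 * n + 6 * n)) + 5 ≡ 5 * (2 * suc n)
    identity = ℕ-Ring.solve-∀

module _ {n : ℕ} (v : Fin n → ℕ) (v≥1 : ∀ i → 1 ≤ v i) (5v≤6n : ∀ i → 5 * v i ≤ 6 * n) where

  Value : ℕ → Set
  Value w = ∃ λ i → v i ≡ w

  HasMultiple : ℕ → Set
  HasMultiple m = ∃ λ i → m ∣ v i

  Separating : ℕ → ℕ → Set
  Separating a m = ∀ i → Apart n (suc m) ((a * v i) % suc m)

  separating-k/[1+kb] : ∀ j b .{{_ : NonZero b}} → suc (suc j * b) ≤ 2 * suc n →
                        (∀ i → v i < suc j * b) → ¬ Value b → ¬ Value (suc (j * b)) →
                        Separating (suc j) (suc j * b)
  separating-k/[1+kb] j b M≤2[1+n] v<kb b-free 1+jb-free i =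
    apart-k*v j b M≤2[1+n] (v≥1 i) (v<kb i) (λ e → b-free (i , e)) (λ e → 1+jb-free (i , e))

  shrink-covers : ∀ c → (∀ {y} → y < c → Value (suc y)) → (∀ {m} → m < suc n → HasMultiple (suc m)) →
                  suc n ≤ 2 * suc c → suc n < 2 * suc c ⊎ Value (suc (suc n)) →
                  ∀ {y} → y < suc n → ∃ λ i → shrink n (v i) ≡ suc y
  shrink-covers c below divisible 1+n≤2b escape {y} y<1+n with y <? c
  ... | yes y<c = let (i , vi≡1+y) = below y<c in i , trans (cong (shrink n) vi≡1+y) (shrink-≤ y<1+n)
  ... | no y≮c with suc n <? 2 * suc y | escape | *-monoʳ-≤ 2 (s≤s (≮⇒≥ y≮c))
  ...   | yes 1+n<2[1+y] | _ | _ =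
    let (i , 1+y∣vi) = divisible y<1+n in i , shrink-multiple 1+y∣vi (v≥1 i) (5v≤6n i) y<1+n 1+n<2[1+y]
  ...   | no 1+n≮2[1+y] | inj₁ 1+n<2b | 2b≤2[1+y] = contradiction (<-≤-trans 1+n<2b 2b≤2[1+y]) 1+n≮2[1+y]
  ...   | no 1+n≮2[1+y] | inj₂ (i , vi≡2+n) | 2b≤2[1+y] =
    i , trans (cong (shrink n) vi≡2+n) (shrink-2+n (≤-antisym (≤-trans 1+n≤2b 2b≤2[1+y]) (≮⇒≥ 1+n≮2[1+y])))

  separating-small-gap : ∀ b .{{_ : NonZero b}} → ¬ Value b → 2 * b ≤ n → ∃₂ Separating
  separating-small-gap b b-free 2b≤n with multiplier 2b≤n
  ... | j , M≤2[1+n] , 6n≤5jb =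
    suc j , suc j * b ,
    separating-k/[1+kb] j b M≤2[1+n] (λ i → ≤-<-trans (vi≤jb i) (m<n+m (j * b) (>-nonZero⁻¹ b))) b-free
      (λ (i , vi≡1+jb) → 1+n≰n (subst (_≤ j * b) vi≡1+jb (vi≤jb i)))
    where
    vi≤jb : ∀ i → v i ≤ j * b
    vi≤jb i = *-cancelˡ-≤ 5 (≤-trans (5v≤6n i) 6n≤5jb)

  separating-large-gap : ∀ c → ¬ Value (suc c) → (∀ {y} → y < c → Value (suc y)) →
                         (∀ {m} → m < suc n → HasMultiple (suc m)) → suc n ≤ 2 * suc c → ∃₂ Separating
  separating-large-gap c b-free below divisible 1+n≤2b =
    3 , 3 * b ,
    separating-k/[1+kb] 2 b M≤2[1+n] (λ i → 5w≤6n⇒w<3y {y = b} (5v≤6n i) 1+n≤2b) b-free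
      (λ (i , vi≡1+2b) → 2+n-free (i , trans vi≡1+2b (cong suc 2b≡1+n)))
    where
    b = suc c
    no-cover : ¬ (suc n < 2 * b ⊎ Value (suc (suc n)))
    no-cover = cannot-cover (shrink n ∘ v) ∘ shrink-covers c below divisible 1+n≤2b
    2b≡1+n : 2 * b ≡ suc n
    2b≡1+n = ≤-antisym (≮⇒≥ (no-cover ∘ inj₁)) 1+n≤2b
    2+n-free : ¬ Value (suc (suc n))
    2+n-free = no-cover ∘ inj₂
    M≤2[1+n] : suc (3 * b) ≤ 2 * suc n
    M≤2[1+n] = begin
      suc (3 * b)   ≤⟨ +-monoˡ-≤ (3 * b) (s≤s (z≤n {c})) ⟩
      4 * b         ≡⟨ *-assoc 2 2 b ⟩
      2 * (2 * b)   ≡⟨ cong (2 *_) 2b≡1+n ⟩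
      2 * suc n     ∎
      where open ≤-Reasoning

  separating : ∃₂ Separating
  separating with least-failure (λ m → any? λ i → suc m ∣? v i) (suc n)
  ... | inj₂ (m , m<1+n , no-multiple , _) =
    1 , m , λ i → subst (λ w → Apart n (suc m) (w % suc m)) (sym (*-identityˡ (v i)))
                        (apart-nondivisor m<1+n (λ 1+m∣vi → no-multiple (i , 1+m∣vi)))
  ... | inj₁ divisible with least-failure (λ y → any? λ i → v i ≟ suc y) (suc n)
  ...   | inj₁ all-taken = ⊥-elim (cannot-cover v all-taken)
  ...   | inj₂ (c , _ , b-free , below) with 2 * suc c ≤? n
  ...     | yes 2b≤n = separating-small-gap (suc c) b-free 2b≤n
  ...     | no 2b≰n = separating-large-gap c b-free below divisible (≰⇒> 2b≰n)

proposition1p6 : (n : ℕ) → 1 ≤ n → (v : Fin n → ℕ) →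
    (∀ i → 1 ≤ v i) → (∀ i → 5 * v i ≤ 6 * n) →
    δ≥ n v ((+ 1) / suc n)
proposition1p6 n _ v v≥1 5v≤6n =
  let (a , m , separates) = separating v v≥1 5v≤6n
  in + a / suc m , λ i → ‖‖≥1/[1+n] n (toℚᵘ-a/M*v a m (v i)) (separates i)
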